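{- Let $H$ be a finite graph which is not a clique and not an independent set. Then $H$ has an edge $uv$ such that at least one of the graphs $H_{uv\to c}$ and $H_{uv\to s}$ contains no induced copy of $H$.
   Context: For a finite graph $H$ and distinct vertices $u,v$ of $H$, the infinite graph $H_{uv\to c}$ (resp. $H_{uv\to s}$) is obtained from $H$ by perturbing the pair $uv$ (deleting the edge $uv$ if present, adding it otherwise) and then blowing up every vertex other than $u$ and $v$ into a countably infinite clique (resp. countably infinite independent set). Blowing up a vertex $w$ into an infinite clique (resp. independent set) means replacing $w$ by infinitely many new vertices that form a clique (resp. independent set), each adjacent to exactly the vertices (or the blow-ups of the vertices) that were adjacent to $w$. -}

module Defs where

open import Data.Nat using (ℕ)
open import Data.Fin using (Fin; _≟_)
open import Data.Bool using (Bool; true; false; not; _∧_; _∨_; _xor_; if_then_else_)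
open import Data.Product using (Σ; _×_; _,_; ∃-syntax)
open import Data.Sum using (_⊎_)
open import Relation.Nullary using (¬_)
open import Relation.Nullary.Decidable using (⌊_⌋)
open import Relation.Binary.PropositionalEquality using (_≡_; _≢_)
open import Function.Definitions using (Injective)
import Data.Nat as ℕ

record Graph (n : ℕ) : Set where
  field
    adj   : Fin n → Fin n → Bool
    sym   : ∀ i j → adj i j ≡ adj j i
    irrefl : ∀ i → adj i i ≡ false
open Graph public

IsClique : ∀ {n} → Graph n → Set
IsClique {n} H = ∀ (i j : Fin n) → i ≢ j → adj H i j ≡ true

IsIndependent : ∀ {n} → Graph n → Set
IsIndependent {n} H = ∀ (i j : Fin n) → adj H i j ≡ false

-- Vertices of the blow-up: pairs (w , k) = k-th copy of w.  Vertices u and v are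
-- not blown up: only the copy (u , 0) resp. (v , 0) is a vertex.
BVertex : ℕ → Set
BVertex n = Fin n × ℕ

Valid : ∀ {n} → Fin n → Fin n → BVertex n → Set
Valid u v (w , k) = (w ≡ u ⊎ w ≡ v) → k ≡ 0

isUV : ∀ {n} → Fin n → Fin n → Fin n → Fin n → Bool
isUV u v a b = (⌊ a ≟ u ⌋ ∧ ⌊ b ≟ v ⌋) ∨ (⌊ a ≟ v ⌋ ∧ ⌊ b ≟ u ⌋)

-- Adjacency in H_{uv→c} (c = true) or H_{uv→s} (c = false).
blowAdj : ∀ {n} → Bool → Graph n → Fin n → Fin n → BVertex n → BVertex n → Bool
blowAdj c H u v (a , i) (b , j) with a ≟ b
... | Relation.Nullary.yes _ = if ⌊ i ℕ.≟ j ⌋ then false else c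
... | Relation.Nullary.no _ = adj H a b xor isUV u v a b

HasInducedCopy : ∀ {n} → Graph n → Bool → Fin n → Fin n → Set
HasInducedCopy {n} H c u v =
  Σ (Fin n → BVertex n) λ f →
    (∀ i → Valid u v (f i)) ×
    Injective _≡_ _≡_ f ×
    (∀ i j → blowAdj c H u v (f i) (f j) ≡ adj H i j)

{-# OPTIONS --safe #-}
module Submission where

open import Defs hiding (sym)
open import Data.Bool using (Bool; true; false; _∧_; _∨_; _xor_; if_then_else_)
import Data.Bool.Properties as Boolₚ
open import Data.Fin using (Fin; toℕ; _≟_)
open import Data.Fin.Properties using (pigeonhole; all?; any?)
open import Data.Nat using (ℕ; zero; suc; _+_; _*_; _∸_)
import Data.Nat as ℕ
open import Data.Nat.Properties
  using (+-comm; +-suc; *-comm; m∸n+n≡m; m≤m*n; n≤1+n; ≤-trans; n<1+n; m≤n⇒∃[o]m+o≡n)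
open import Data.Product using (_×_; ∃; ∃₂; ∃-syntax; _,_; proj₁)
open import Data.Sum using (_⊎_; inj₁; inj₂)
open import Function.Base using (_∘_; case_of_)
open import Function.Definitions using (Injective)
import Function.Endo.Propositional as Endo
open import Level using (Level)
open import Relation.Binary.Core using (Rel; _⇒_; _Preserves_⟶_)
open import Relation.Binary.PropositionalEquality
  using (_≡_; _≢_; refl; sym; trans; cong; cong₂; cong-app; subst; subst₂; ≢-sym; module ≡-Reasoning)
open import Relation.Nullary using (¬_; Dec; yes; no; contradiction; ¬?)
open import Relation.Nullary.Decidable
  using (⌊_⌋; does; _×-dec_; _⊎-dec_; _→-dec_; isYes≗does; dec-true; dec-false; decidable-stable)

{-
Call adjacent vertices x, y of H true twins if every other vertex is adjacent to both or to
neither. Let h be a self-map of V(H) preserving adjacency and non-adjacency, and e a positive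
power of h that is idempotent at v.  If u, v are true twins, then w = e(v) is adjacent to u but
not to v, so w = v; hence h cannot avoid v.

If H has true twins u, v, deleting uv turns them into non-adjacent twins, so the base map of a
copy of H in H_{uv→s}, followed by merging v into u, is such an h avoiding v.

If H has no true twins, take any edge uv.  Two vertices of a copy of H in H_{uv→c} over the same
vertex of H would be true twins, so the base map h is injective, and it sends edges of H to
edges of H − uv.  Some power of h fixes both u and v, and then uv is an edge of H − uv.

Neither argument needs u and v to be left unblown.
-}

module _ {a : Level} {A : Set a} where
  open Endo A public using (_^_; ^-homo)

module _ {a : Level} {A : Set a} (h : A → A) where

  ^-+ : ∀ m k x → (h ^ (m + k)) x ≡ (h ^ m) ((h ^ k) x)
  ^-+ m k = cong-app (^-homo h m k)

  ^-comm : ∀ m k x → (h ^ m) ((h ^ k) x) ≡ (h ^ k) ((h ^ m) x)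
  ^-comm m k x = begin
    (h ^ m) ((h ^ k) x) ≡⟨ ^-+ m k x ⟨
    (h ^ (m + k)) x     ≡⟨ cong (λ l → (h ^ l) x) (+-comm m k) ⟩
    (h ^ (k + m)) x     ≡⟨ ^-+ k m x ⟩
    (h ^ k) ((h ^ m) x) ∎
    where open ≡-Reasoning

  ^-fixed-* : ∀ {p x} → (h ^ p) x ≡ x → ∀ m → (h ^ (m * p)) x ≡ x
  ^-fixed-* fixed zero = refl
  ^-fixed-* {p} {x} fixed (suc m) = begin
    (h ^ (p + m * p)) x       ≡⟨ ^-+ p (m * p) x ⟩
    (h ^ p) ((h ^ (m * p)) x) ≡⟨ cong (h ^ p) (^-fixed-* fixed m) ⟩
    (h ^ p) x                 ≡⟨ fixed ⟩
    x                         ∎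
    where open ≡-Reasoning

  ^-injective : Injective _≡_ _≡_ h → ∀ k → Injective _≡_ _≡_ (h ^ k)
  ^-injective h-injective zero    eq = eq
  ^-injective h-injective (suc k) eq = ^-injective h-injective k (h-injective eq)

  ^-preserves : ∀ {ℓ} {R : Rel A ℓ} → h Preserves R ⟶ R → ∀ k → (h ^ k) Preserves R ⟶ R
  ^-preserves preserves zero    r = r
  ^-preserves {R = R} preserves (suc k) r = preserves (^-preserves {R = R} preserves k r)

module _ {n : ℕ} (h : Fin n → Fin n) where

  eventuallyPeriodic : ∀ x → ∃₂ λ s p → (h ^ suc p) ((h ^ s) x) ≡ (h ^ s) x
  eventuallyPeriodic x with i , j , i<j , hⁱx≡hʲx ← pigeonhole (n<1+n n) (λ i → (h ^ toℕ i) x)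
                       with o , i+o≡j ← m≤n⇒∃[o]m+o≡n i<j = toℕ i , o , (begin
    (h ^ suc o) ((h ^ toℕ i) x) ≡⟨ ^-+ h (suc o) (toℕ i) x ⟨
    (h ^ (suc o + toℕ i)) x     ≡⟨ cong (λ l → (h ^ l) x) suc-o+i≡j ⟩
    (h ^ toℕ j) x               ≡⟨ hⁱx≡hʲx ⟨
    (h ^ toℕ i) x               ∎)
    where
    open ≡-Reasoning
    suc-o+i≡j : suc o + toℕ i ≡ toℕ j
    suc-o+i≡j = trans (+-comm (suc o) (toℕ i)) (trans (+-suc (toℕ i) o) i+o≡j)

  idempotentPowerAt : ∀ x → ∃ λ k → (h ^ suc k) ((h ^ suc k) x) ≡ (h ^ suc k) x
  idempotentPowerAt x with s , p , periodic ← eventuallyPeriodic x = p + s * suc p , (begin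
    (h ^ K) ((h ^ K) x)       ≡⟨ cong (h ^ K) (sym K-via-y) ⟩
    (h ^ K) ((h ^ (K ∸ s)) y) ≡⟨ ^-comm h K (K ∸ s) y ⟩
    (h ^ (K ∸ s)) ((h ^ K) y) ≡⟨ cong (h ^ (K ∸ s)) (^-fixed-* h {suc p} periodic (suc s)) ⟩
    (h ^ (K ∸ s)) y           ≡⟨ K-via-y ⟩
    (h ^ K) x                 ∎)
    where
    open ≡-Reasoning
    K = suc s * suc p
    y = (h ^ s) x
    K-via-y : (h ^ (K ∸ s)) y ≡ (h ^ K) x
    K-via-y = trans (sym (^-+ h (K ∸ s) s x))
                    (cong (λ l → (h ^ l) x) (m∸n+n≡m (≤-trans (n≤1+n s) (m≤m*n (suc s) (suc p)))))

  module _ (h-injective : Injective _≡_ _≡_ h) where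

    fixingPower : ∀ x → ∃ λ k → (h ^ suc k) x ≡ x
    fixingPower x with k , idempotent ← idempotentPowerAt x =
      k , ^-injective h h-injective (suc k) idempotent

    commonFixingPower : ∀ x y → ∃ λ k → (h ^ suc k) x ≡ x × (h ^ suc k) y ≡ y
    commonFixingPower x y with p , x-fixed ← fixingPower x | q , y-fixed ← fixingPower y =
      q + p * suc q ,
      subst (λ m → (h ^ m) x ≡ x) (*-comm (suc q) (suc p)) (^-fixed-* h {suc p} x-fixed (suc q)) ,
      ^-fixed-* h {suc q} y-fixed (suc p)

    injectiveEndo-into-subrelation : ∀ {ℓ ℓ′} {R : Rel (Fin n) ℓ} {R′ : Rel (Fin n) ℓ′} →
      R′ ⇒ R → h Preserves R ⟶ R′ → R ⇒ R′
    injectiveEndo-into-subrelation {R = R} {R′} R′⇒R preserves {x} {y} r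
      with k , x-fixed , y-fixed ← commonFixingPower x y =
      subst₂ R′ x-fixed y-fixed (preserves (^-preserves h {R = R} (R′⇒R ∘ preserves) k r))

module _ {n : ℕ} where

  adjacent⇒≢ : (H : Graph n) {x y : Fin n} → adj H x y ≡ true → x ≢ y
  adjacent⇒≢ H {x} x~y refl = case trans (sym (irrefl H x)) x~y of λ ()

  TrueTwins : Graph n → Fin n → Fin n → Set
  TrueTwins H x y = adj H x y ≡ true × (∀ w → w ≢ x → w ≢ y → adj H x w ≡ adj H y w)

  trueTwins? : (H : Graph n) → ∀ x y → Dec (TrueTwins H x y)
  trueTwins? H x y = (adj H x y Boolₚ.≟ true) ×-dec
    all? λ w → ¬? (w ≟ x) →-dec ¬? (w ≟ y) →-dec (adj H x w Boolₚ.≟ adj H y w)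

  IsFullEndomorphism : Graph n → (Fin n → Fin n) → Set
  IsFullEndomorphism H h = ∀ i j → adj H i j ≡ adj H (h i) (h j)

  fullEndomorphism-^ : ∀ {H h} → IsFullEndomorphism H h → ∀ k → IsFullEndomorphism H (h ^ k)
  fullEndomorphism-^ h-full zero    i j = refl
  fullEndomorphism-^ {H} {h} h-full (suc k) i j =
    trans (fullEndomorphism-^ {H} {h} h-full k i j) (h-full _ _)

  fullEndomorphism-idempotentAt-trueTwin : ∀ {H e u v} → TrueTwins H u v → IsFullEndomorphism H e →
    e (e v) ≡ e v → e v ≡ v
  fullEndomorphism-idempotentAt-trueTwin {H} {e} {u} {v} (u~v , twins) e-full idempotent with e v ≟ v
  ... | yes w≡v = w≡v
  ... | no  w≢v = case trans (sym u~w) (trans (twins w w≢u w≢v) v≁w) of λ ()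
    where
    w = e v
    v≁w : adj H v w ≡ false
    v≁w = trans (e-full v w) (trans (cong (adj H w) idempotent) (irrefl H w))
    u~w : adj H u w ≡ true
    u~w = trans (e-full u w) (trans (cong (adj H (e u)) idempotent) (trans (sym (e-full u v)) u~v))
    w≢u : w ≢ u
    w≢u = ≢-sym (adjacent⇒≢ H u~w)

  ¬fullEndomorphism-avoiding-trueTwin : ∀ {H u v h} → TrueTwins H u v → IsFullEndomorphism H h →
    ¬ (∀ i → h i ≢ v)
  ¬fullEndomorphism-avoiding-trueTwin {H} {v = v} {h} twins h-full avoids-v
    with k , idempotent ← idempotentPowerAt h v =
    avoids-v ((h ^ k) v)
      (fullEndomorphism-idempotentAt-trueTwin {H} twins (fullEndomorphism-^ {H} {h} h-full (suc k)) idempotent)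

  UVPair : Fin n → Fin n → Fin n → Fin n → Set
  UVPair u v a b = (a ≡ u × b ≡ v) ⊎ (a ≡ v × b ≡ u)

  uvPair? : ∀ u v a b → Dec (UVPair u v a b)
  uvPair? u v a b = (a ≟ u ×-dec b ≟ v) ⊎-dec (a ≟ v ×-dec b ≟ u)

  isUV≡does : ∀ u v a b → isUV u v a b ≡ does (uvPair? u v a b)
  isUV≡does u v a b = cong₂ _∨_ (cong₂ _∧_ (isYes≗does (a ≟ u)) (isYes≗does (b ≟ v)))
                                (cong₂ _∧_ (isYes≗does (a ≟ v)) (isYes≗does (b ≟ u)))

  isUV-true : ∀ {u v a b} → UVPair u v a b → isUV u v a b ≡ true
  isUV-true {u} {v} {a} {b} pair = trans (isUV≡does u v a b) (dec-true (uvPair? u v a b) pair)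

  isUV-false : ∀ {u v a b} → ¬ UVPair u v a b → isUV u v a b ≡ false
  isUV-false {u} {v} {a} {b} ¬pair = trans (isUV≡does u v a b) (dec-false (uvPair? u v a b) ¬pair)

  perturbedAdj : Graph n → Fin n → Fin n → Fin n → Fin n → Bool
  perturbedAdj H u v a b = adj H a b xor isUV u v a b

  perturbedAdj-¬UVPair : ∀ H {u v a b} → ¬ UVPair u v a b → perturbedAdj H u v a b ≡ adj H a b
  perturbedAdj-¬UVPair H {a = a} {b} ¬pair =
    trans (cong (adj H a b xor_) (isUV-false ¬pair)) (Boolₚ.xor-identityʳ (adj H a b))

  module _ (H : Graph n) {u v : Fin n} (u~v : adj H u v ≡ true) where

    UVPair⇒adjacent : ∀ {a b} → UVPair u v a b → adj H a b ≡ true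
    UVPair⇒adjacent (inj₁ (refl , refl)) = u~v
    UVPair⇒adjacent (inj₂ (refl , refl)) = trans (Graph.sym H v u) u~v

    perturbedAdj-UVPair : ∀ {a b} → UVPair u v a b → perturbedAdj H u v a b ≡ false
    perturbedAdj-UVPair pair = cong₂ _xor_ (UVPair⇒adjacent pair) (isUV-true pair)

    perturbedAdj⇒adjacent : ∀ {a b} → perturbedAdj H u v a b ≡ true → adj H a b ≡ true
    perturbedAdj⇒adjacent {a} {b} a~b with uvPair? u v a b
    ... | yes pair = UVPair⇒adjacent pair
    ... | no ¬pair = trans (sym (perturbedAdj-¬UVPair H ¬pair)) a~b

  merge : Fin n → Fin n → Fin n → Fin n
  merge u v a = if ⌊ a ≟ v ⌋ then u else a

  merge-≢ : ∀ {u v} → u ≢ v → ∀ a → merge u v a ≢ v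
  merge-≢ {v = v} u≢v a with a ≟ v
  ... | yes _   = u≢v
  ... | no  a≢v = a≢v

  merge-UVPair : ∀ {u v a b} → u ≢ v → UVPair u v a b → merge u v a ≡ u × merge u v b ≡ u
  merge-UVPair {u} {v} u≢v (inj₁ (refl , refl)) with u ≟ v | v ≟ v
  ... | yes u≡v | _       = contradiction u≡v u≢v
  ... | no _    | yes _   = refl , refl
  ... | no _    | no v≢v  = contradiction refl v≢v
  merge-UVPair {u} {v} u≢v (inj₂ (refl , refl)) with v ≟ v | u ≟ v
  ... | yes _ | yes u≡v = contradiction u≡v u≢v
  ... | yes _ | no _    = refl , refl
  ... | no v≢v | _      = contradiction refl v≢v

  adj-merge : ∀ {H u v a b} → TrueTwins H u v → a ≢ b → ¬ UVPair u v a b →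
    adj H a b ≡ adj H (merge u v a) (merge u v b)
  adj-merge {H} {u} {v} {a} {b} (_ , sameNeighbours) a≢b ¬pair with a ≟ v | b ≟ v
  ... | yes refl | yes refl = contradiction refl a≢b
  ... | yes refl | no  b≢v  = sym (sameNeighbours b (λ b≡u → ¬pair (inj₂ (refl , b≡u))) b≢v)
  ... | no  a≢v  | yes refl = begin
    adj H a v ≡⟨ Graph.sym H a v ⟩
    adj H v a ≡⟨ sameNeighbours a (λ a≡u → ¬pair (inj₁ (a≡u , refl))) a≢v ⟨
    adj H u a ≡⟨ Graph.sym H u a ⟩
    adj H a u ∎
    where open ≡-Reasoning
  ... | no  _    | no  _    = refl

  baseAdj : Bool → Graph n → Fin n → Fin n → Fin n → Fin n → Bool
  baseAdj c H u v a b = if ⌊ a ≟ b ⌋ then c else perturbedAdj H u v a b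

  baseAdj-diagonal : ∀ c H u v a → baseAdj c H u v a a ≡ c
  baseAdj-diagonal c H u v a with a ≟ a
  ... | yes _   = refl
  ... | no  a≢a = contradiction refl a≢a

  baseAdj-offDiagonal : ∀ c H u v {a b} → a ≢ b → baseAdj c H u v a b ≡ perturbedAdj H u v a b
  baseAdj-offDiagonal c H u v {a} {b} a≢b with a ≟ b
  ... | yes a≡b = contradiction a≡b a≢b
  ... | no  _   = refl

  blowAdj-distinct : ∀ c H u v {p q : BVertex n} → p ≢ q →
    blowAdj c H u v p q ≡ baseAdj c H u v (proj₁ p) (proj₁ q)
  blowAdj-distinct c H u v {a , i} {b , j} p≢q with a ≟ b
  ... | no  _    = refl
  ... | yes refl with i ℕ.≟ j
  ...   | yes refl = contradiction refl p≢q
  ...   | no  _    = refl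

  baseAdj-independent-merge : ∀ {H u v} → TrueTwins H u v → ∀ a b →
    baseAdj false H u v a b ≡ adj H (merge u v a) (merge u v b)
  baseAdj-independent-merge {H} {u} {v} twins@(u~v , _) a b with a ≟ b
  ... | yes refl = sym (irrefl H (merge u v a))
  ... | no  a≢b with uvPair? u v a b
  ...   | no ¬pair = trans (perturbedAdj-¬UVPair H ¬pair) (adj-merge {H} twins a≢b ¬pair)
  ...   | yes pair with merge-UVPair (adjacent⇒≢ H u~v) pair
  ...     | a↦u , b↦u =
    trans (perturbedAdj-UVPair H u~v pair) (sym (trans (cong₂ (adj H) a↦u b↦u) (irrefl H u)))

module _ {n : ℕ} {H : Graph n} {c : Bool} {u v : Fin n} {f : Fin n → BVertex n}
         (f-injective : Injective _≡_ _≡_ f)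
         (f-induced : ∀ i j → blowAdj c H u v (f i) (f j) ≡ adj H i j) where

  private
    base : Fin n → Fin n
    base = proj₁ ∘ f

  adj≡baseAdj : ∀ {i j} → i ≢ j → adj H i j ≡ baseAdj c H u v (base i) (base j)
  adj≡baseAdj {i} {j} i≢j = trans (sym (f-induced i j)) (blowAdj-distinct c H u v (i≢j ∘ f-injective))

  sameBase⇒trueTwins : c ≡ true → ∀ {i j} → i ≢ j → base i ≡ base j → TrueTwins H i j
  sameBase⇒trueTwins refl {i} {j} i≢j same = i~j , sameNeighbours
    where
    i~j : adj H i j ≡ true
    i~j = trans (adj≡baseAdj i≢j)
                (trans (cong (λ b → baseAdj true H u v b (base j)) same) (baseAdj-diagonal true H u v (base j)))
    sameNeighbours : ∀ w → w ≢ i → w ≢ j → adj H i w ≡ adj H j w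
    sameNeighbours w w≢i w≢j = begin
      adj H i w                            ≡⟨ adj≡baseAdj (≢-sym w≢i) ⟩
      baseAdj true H u v (base i) (base w) ≡⟨ cong (λ b → baseAdj true H u v b (base w)) same ⟩
      baseAdj true H u v (base j) (base w) ≡⟨ adj≡baseAdj (≢-sym w≢j) ⟨
      adj H j w                            ∎
      where open ≡-Reasoning

  mergedBase-fullEndomorphism : c ≡ false → TrueTwins H u v → IsFullEndomorphism H (merge u v ∘ base)
  mergedBase-fullEndomorphism refl twins i j with i ≟ j
  ... | yes refl = trans (irrefl H i) (sym (irrefl H (merge u v (base i))))
  ... | no  i≢j  = trans (adj≡baseAdj i≢j) (baseAdj-independent-merge {H = H} twins (base i) (base j))

module _ {n : ℕ} (H : Graph n) where

  noTrueTwins⇒¬cliqueCopy : ∀ {u v} → ¬ ∃₂ (TrueTwins H) → adj H u v ≡ true →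
    ¬ HasInducedCopy H true u v
  noTrueTwins⇒¬cliqueCopy {u} {v} noTwins u~v (f , _ , f-injective , f-induced) =
    case trans (sym (perturbedAdj-UVPair H u~v (inj₁ (refl , refl))))
               (injectiveEndo-into-subrelation base base-injective {R = Adjacent} {R′ = PerturbedAdjacent}
                  (perturbedAdj⇒adjacent H u~v) base-preserves u~v)
    of λ ()
    where
    Adjacent PerturbedAdjacent : Fin n → Fin n → Set
    Adjacent a b = adj H a b ≡ true
    PerturbedAdjacent a b = perturbedAdj H u v a b ≡ true
    base : Fin n → Fin n
    base = proj₁ ∘ f
    base-injective : Injective _≡_ _≡_ base
    base-injective {i} {j} same with i ≟ j
    ... | yes i≡j = i≡j
    ... | no  i≢j = contradiction (i , j , sameBase⇒trueTwins f-injective f-induced refl i≢j same) noTwins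
    base-preserves : base Preserves Adjacent ⟶ PerturbedAdjacent
    base-preserves {i} {j} i~j = begin
      perturbedAdj H u v (base i) (base j) ≡⟨ baseAdj-offDiagonal true H u v (i≢j ∘ base-injective) ⟨
      baseAdj true H u v (base i) (base j) ≡⟨ adj≡baseAdj f-injective f-induced i≢j ⟨
      adj H i j                            ≡⟨ i~j ⟩
      true                                 ∎
      where
      open ≡-Reasoning
      i≢j = adjacent⇒≢ H i~j

  trueTwins⇒¬independentCopy : ∀ {u v} → TrueTwins H u v → ¬ HasInducedCopy H false u v
  trueTwins⇒¬independentCopy twins@(u~v , _) (f , _ , f-injective , f-induced) =
    ¬fullEndomorphism-avoiding-trueTwin {H = H} twins
      (mergedBase-fullEndomorphism f-injective f-induced refl twins)
      (λ i → merge-≢ (adjacent⇒≢ H u~v) (proj₁ (f i)))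

  edge-of-¬independent : ¬ IsIndependent H → ∃₂ λ u v → adj H u v ≡ true
  edge-of-¬independent ¬independent =
    decidable-stable (any? λ u → any? λ v → adj H u v Boolₚ.≟ true)
      λ noEdge → ¬independent λ u v → Boolₚ.¬-not λ u~v → noEdge (u , v , u~v)

lemma4p1 : ∀ (n : ℕ) (H : Graph n) → ¬ IsClique H → ¬ IsIndependent H →
    ∃[ u ] ∃[ v ] (adj H u v ≡ true ×
      (¬ HasInducedCopy H true u v ⊎ ¬ HasInducedCopy H false u v))
lemma4p1 n H _ ¬independent with any? (λ u → any? (λ v → trueTwins? H u v))
... | yes (u , v , twins) = u , v , proj₁ twins , inj₂ (trueTwins⇒¬independentCopy H twins)
... | no noTwins with u , v , u~v ← edge-of-¬independent H ¬independent =
  u , v , u~v , inj₁ (noTrueTwins⇒¬cliqueCopy H noTwins u~v)
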